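{- Let $q$ be a power of $2$, let $b,c\in\mathbb{F}_{q^6}^*$ and let $$U_{b,c}=\{(x,\;x^{q}+b\,x^{q^{3}}+c\,x^{q^{5}}) : x\in\mathbb{F}_{q^6}\}\subseteq \mathbb{F}_{q^6}\times\mathbb{F}_{q^6}.$$ If $c\neq b^{q^2+1}$, then $U_{b,c}$ is not $\Gamma\mathrm{L}(2,q^6)$-equivalent to any of the following $\mathbb{F}_q$-subspaces of $\mathbb{F}_{q^6}\times\mathbb{F}_{q^6}$: (a) $U^{1}_s=\{(x,x^{q^s}) : x\in\mathbb{F}_{q^6}\}$ with $s\in\{1,5\}$; (b) $U^{2}_{s,\delta}=\{(x,\delta x^{q^s}+x^{q^{6-s}}) : x\in\mathbb{F}_{q^6}\}$ with $s\in\{1,5\}$ and $\delta\in\mathbb{F}_{q^6}$ such that $\mathrm{N}_{q^6/q}(\delta)\notin\{0,1\}$; (c) $U^{3}_{s,\delta}=\{(x,\delta x^{q^s}+x^{q^{s+3}}) : x\in\mathbb{F}_{q^6}\}$ with $1\le s\le 5$, $\gcd(s,3)=1$, and $\delta\in\mathbb{F}_{q^6}$ with $\mathrm{N}_{q^6/q^3}(\delta)\notin\{0,1\}$, for those parameters for which this subspace is maximum scattered.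
   Context: For $\ell\mid 6$, $\mathrm{N}_{q^6/q^\ell}(x)=x^{(q^6-1)/(q^\ell-1)}$. Two $\mathbb{F}_q$-subspaces $U,U'$ of $\mathbb{F}_{q^6}^2$ are $\Gamma\mathrm{L}(2,q^6)$-equivalent if there is a semilinear map $v\mapsto M v^{\rho}$ ($M\in\mathrm{GL}(2,q^6)$, $\rho\in\mathrm{Aut}(\mathbb{F}_{q^6})$ applied coordinatewise) mapping $U$ onto $U'$. An $\mathbb{F}_q$-subspace $U$ of $\mathbb{F}_{q^6}^2$ is scattered if $\dim_{\mathbb{F}_q}(U\cap\langle v\rangle_{\mathbb{F}_{q^6}})\le 1$ for every nonzero $v$, and maximum scattered if moreover $\dim_{\mathbb{F}_q}U=6$. -}

module Defs where

open import Level using (0ℓ)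
open import Data.Nat as ℕ using (ℕ; zero; suc)
open import Data.Fin using (Fin; zero; suc)
open import Data.Product using (Σ; ∃; _×_; _,_)
open import Data.Sum using (_⊎_)
open import Relation.Binary.PropositionalEquality using (_≡_)
open import Relation.Nullary using (¬_)
open import Algebra.Bundles using (CommutativeRing)

record IsFiniteFieldOfOrder (R : CommutativeRing 0ℓ 0ℓ) (n : ℕ) : Set where
  open CommutativeRing R
  field
    0≉1      : ¬ (0# ≈ 1#)
    inverse  : ∀ x → ¬ (x ≈ 0#) → ∃ λ y → x * y ≈ 1#
    enum     : Fin n → Carrier
    enum-inj : ∀ i j → enum i ≈ enum j → i ≡ j
    enum-sur : ∀ x → ∃ λ i → enum i ≈ x

-- Everything below is relative to a field R (intended: F_{q^6}) and q.
module FieldDefs (R : CommutativeRing 0ℓ 0ℓ) (q : ℕ) where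
  open CommutativeRing R hiding (zero; Carrier; _≈_; 0#; 1#)
  open CommutativeRing R public using (Carrier; _≈_; 0#; 1#)

  pow : Carrier → ℕ → Carrier
  pow x zero    = 1#
  pow x (suc n) = x * pow x n

  fr : ℕ → Carrier → Carrier
  fr k x = pow x (q ℕ.^ k)

  -- exponent (q^m - 1)/(q^ℓ - 1) for ℓ ∣ m, written as the geometric sum
  -- Σ_{i < k} q^{ℓ i}  where k = m/ℓ
  geomExp : (ℓ k : ℕ) → ℕ
  geomExp ℓ zero    = 0
  geomExp ℓ (suc k) = 1 ℕ.+ (q ℕ.^ ℓ) ℕ.* geomExp ℓ k

  N6/1 : Carrier → Carrier
  N6/1 x = pow x (geomExp 1 6)

  N6/3 : Carrier → Carrier
  N6/3 x = pow x (geomExp 3 2)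

  InFq : Carrier → Set
  InFq t = pow t q ≈ t

  V : Set
  V = Carrier × Carrier

  _≈V_ : V → V → Set
  (x₁ , y₁) ≈V (x₂ , y₂) = (x₁ ≈ x₂) × (y₁ ≈ y₂)

  0V : V
  0V = (0# , 0#)

  _+V_ : V → V → V
  (x₁ , y₁) +V (x₂ , y₂) = (x₁ + x₂ , y₁ + y₂)

  _·V_ : Carrier → V → V
  t ·V (x , y) = (t * x , t * y)

  Sub : Set₁
  Sub = V → Set

  Graph : (Carrier → Carrier) → Sub
  Graph f v = ∃ λ x → v ≈V (x , f x)

  U-bc : Carrier → Carrier → Sub
  U-bc b c = Graph (λ x → fr 1 x + (b * fr 3 x + c * fr 5 x))

  U1 : ℕ → Sub
  U1 s = Graph (λ x → fr s x)

  U2 : ℕ → Carrier → Sub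
  U2 s δ = Graph (λ x → δ * fr s x + fr (6 ℕ.∸ s) x)

  U3 : ℕ → Carrier → Sub
  U3 s δ = Graph (λ x → δ * fr s x + fr (s ℕ.+ 3) x)

  record FieldAut : Set where
    field
      ρ      : Carrier → Carrier
      ρ-cong : ∀ x y → x ≈ y → ρ x ≈ ρ y
      ρ-+    : ∀ x y → ρ (x + y) ≈ ρ x + ρ y
      ρ-*    : ∀ x y → ρ (x * y) ≈ ρ x * ρ y
      ρ-1    : ρ 1# ≈ 1#
      ρ-inj  : ∀ x y → ρ x ≈ ρ y → x ≈ y
      ρ-sur  : ∀ y → ∃ λ x → ρ x ≈ y

  record GL2 : Set where
    field
      a₁₁ a₁₂ a₂₁ a₂₂ : Carrier
      det≉0 : ¬ (a₁₁ * a₂₂ - a₁₂ * a₂₁ ≈ 0#)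

  semilin : GL2 → FieldAut → V → V
  semilin M σ (x , y) =
    (a₁₁ * ρ x + a₁₂ * ρ y , a₂₁ * ρ x + a₂₂ * ρ y)
    where open GL2 M
          open FieldAut σ

  ΓLEquiv : Sub → Sub → Set
  ΓLEquiv U U' = Σ GL2 λ M → Σ FieldAut λ σ →
    ((u : V) → U u → U' (semilin M σ u)) ×
    ((w : V) → U' w → ∃ λ u → U u × (semilin M σ u ≈V w))

  InSpan : V → V → Set
  InSpan v u = ∃ λ t → u ≈V (t ·V v)

  sumV : (n : ℕ) → (Fin n → V) → V
  sumV zero    f = 0V
  sumV (suc n) f = f zero +V sumV n (λ i → f (suc i))

  -- dim_{F_q}(U ∩ ⟨v⟩) ≤ 1: any two of its elements are F_q-linearly dependent
  DimAtMostOne : Sub → Set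
  DimAtMostOne W = ∀ u₁ u₂ → W u₁ → W u₂ →
    ∃ λ l → ∃ λ m → InFq l × InFq m × (¬ (l ≈ 0#) ⊎ ¬ (m ≈ 0#)) ×
      (((l ·V u₁) +V (m ·V u₂)) ≈V 0V)

  Scattered : Sub → Set
  Scattered U = ∀ v → ¬ (v ≈V 0V) → DimAtMostOne (λ u → U u × InSpan v u)

  HasFqDim : Sub → ℕ → Set
  HasFqDim U n = Σ (Fin n → V) λ e →
    (∀ i → U (e i)) ×
    (∀ u → U u → ∃ λ (l : Fin n → Carrier) → (∀ i → InFq (l i)) ×
        (u ≈V sumV n (λ i → l i ·V e i))) ×
    (∀ (l : Fin n → Carrier) → (∀ i → InFq (l i)) →
        sumV n (λ i → l i ·V e i) ≈V 0V → ∀ i → l i ≈ 0#)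

  MaximumScattered : Sub → Set
  MaximumScattered U = Scattered U × HasFqDim U 6

-- Absorbing the field automorphism into b and c turns a ΓL(2,q⁶)-equivalence from U_{b,c} onto the graph
-- of g into an invertible matrix (a β; γ d) with γy + d·f(y) = g(ay + β·f(y)) for all y, where
-- f(y) = y^q + b y^{q³} + c y^{q⁵}. Both sides are q-polynomials of q-degree < 6, and such a polynomial is
-- determined by the function it defines: as an ordinary polynomial it has degree ≤ q⁵, fewer than the q⁶
-- elements of the field. Comparing the coefficients of x^{q^i} gives β = d = 0, contradicting invertibility,
-- except for U²_{s,δ}, where they give c = b^{q²+1} instead.
module Submission where

open import Level using (0ℓ)
open import Defs
open import Data.Nat as ℕ using (ℕ; zero; suc; _≤_; s≤s)
import Data.Nat.Properties as ℕ
open import Data.Fin as Fin using (Fin; zero; suc; punchIn; punchOut; toℕ; #_)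
import Data.Fin.Properties as Fin
open import Data.Nat.Divisibility using (_∣_; divides; m∣m*n; ∣m⇒∣m*n)
open import Data.Vec.Functional using (Vector; head; tail; _∷_; [])
open import Data.Empty using (⊥; ⊥-elim)
open import Function using (_∘_; flip)
open import Data.Product using (∃; _,_; proj₁; proj₂)
open import Relation.Binary.PropositionalEquality as ≡ using (_≡_; _≢_)
open import Relation.Nullary using (¬_; Dec; yes; no)
open import Relation.Binary.Definitions using (tri<; tri≈; tri>)
open import Algebra.Bundles using (CommutativeMonoid; CommutativeRing)

^-injectiveʳ : ∀ {q a b} → 1 ℕ.< q → q ℕ.^ a ≡ q ℕ.^ b → a ≡ b
^-injectiveʳ {q} {a} {b} 1<q q^a≡q^b with ℕ.<-cmp a b
... | tri< a<b _ _ = ⊥-elim (ℕ.<⇒≢ (ℕ.^-monoʳ-< q 1<q a<b) q^a≡q^b)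
... | tri≈ _ a≡b _ = a≡b
... | tri> _ _ a>b = ⊥-elim (ℕ.>⇒≢ (ℕ.^-monoʳ-< q 1<q a>b) q^a≡q^b)

1+q^m≤q^[1+m] : ∀ {q} m → 1 ℕ.< q → suc (q ℕ.^ m) ≤ q ℕ.^ suc m
1+q^m≤q^[1+m] {q@(suc _)} m 1<q = begin
  suc (q ℕ.^ m)         ≤⟨ ℕ.+-monoˡ-≤ (q ℕ.^ m) (ℕ.m^n>0 q m) ⟩
  q ℕ.^ m ℕ.+ q ℕ.^ m   ≡⟨ ≡.cong (q ℕ.^ m ℕ.+_) (≡.sym (ℕ.+-identityʳ _)) ⟩
  2 ℕ.* q ℕ.^ m         ≤⟨ ℕ.*-monoˡ-≤ (q ℕ.^ m) 1<q ⟩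
  q ℕ.* q ℕ.^ m         ∎
  where open ℕ.≤-Reasoning

2∣2^h : ∀ {h} → 1 ≤ h → 2 ∣ 2 ℕ.^ h
2∣2^h {suc h} _ = m∣m*n (2 ℕ.^ h)

module SumProperties (M : CommutativeMonoid 0ℓ 0ℓ) where
  open CommutativeMonoid M
  open import Algebra.Properties.CommutativeMonoid.Sum M using (sum; sum-remove; sum-cong-≋; sum-replicate-zero)

  sum-single : ∀ {n} (f : Vector Carrier (suc n)) i → (∀ j → j ≢ i → f j ≈ ε) → sum f ≈ f i
  sum-single {n} f i f≈ε = trans (sum-remove {i = i} f) (trans (∙-congˡ rest≈ε) (identityʳ (f i)))
    where
    rest≈ε : sum (λ j → f (punchIn i j)) ≈ ε
    rest≈ε = trans (sum-cong-≋ (λ j → f≈ε _ (Fin.punchInᵢ≢i i j))) (sum-replicate-zero n)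

module FieldProperties (R : CommutativeRing 0ℓ 0ℓ) where
  open CommutativeRing R hiding (zero)
  open import Relation.Binary.Reasoning.Setoid setoid
  open import Algebra.Solver.Ring.NaturalCoefficients.Default commutativeSemiring
  open import Algebra.Properties.Semiring.Exp semiring using (_^_)
  import Algebra.Properties.CommutativeMonoid.Sum *-commutativeMonoid as Π

  x*y≈1⇒y≉0 : ¬ 0# ≈ 1# → ∀ {x y} → x * y ≈ 1# → y ≉ 0#
  x*y≈1⇒y≉0 0≉1 {x} xy≈1 y≈0 = 0≉1 (trans (sym (zeroʳ x)) (trans (*-congˡ (sym y≈0)) xy≈1))

  x*y≈1⇒x≉0 : ¬ 0# ≈ 1# → ∀ {x y} → x * y ≈ 1# → x ≉ 0#
  x*y≈1⇒x≉0 0≉1 xy≈1 = x*y≈1⇒y≉0 0≉1 (trans (*-comm _ _) xy≈1)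

  module _ (inverse : ∀ x → x ≉ 0# → ∃ λ y → x * y ≈ 1#) where

    *-cancelˡ : ∀ {x y z} → x ≉ 0# → x * y ≈ x * z → y ≈ z
    *-cancelˡ {x} {y} {z} x≉0 xy≈xz with inverse x x≉0
    ... | w , xw≈1 = begin
      y             ≈⟨ sym (*-identityˡ y) ⟩
      1# * y        ≈⟨ *-congʳ (sym xw≈1) ⟩
      (x * w) * y   ≈⟨ solve 3 (λ x w y → (x :* w) :* y := w :* (x :* y)) refl x w y ⟩
      w * (x * y)   ≈⟨ *-congˡ xy≈xz ⟩
      w * (x * z)   ≈⟨ solve 3 (λ x w z → w :* (x :* z) := (x :* w) :* z) refl x w z ⟩
      (x * w) * z   ≈⟨ *-congʳ xw≈1 ⟩
      1# * z        ≈⟨ *-identityˡ z ⟩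
      z             ∎

    x≉0∧x*y≈0⇒y≈0 : ∀ {x y} → x ≉ 0# → x * y ≈ 0# → y ≈ 0#
    x≉0∧x*y≈0⇒y≈0 {x} x≉0 xy≈0 = *-cancelˡ x≉0 (trans xy≈0 (sym (zeroʳ x)))

    y≉0∧x*y≈0⇒x≈0 : ∀ {x y} → y ≉ 0# → x * y ≈ 0# → x ≈ 0#
    y≉0∧x*y≈0⇒x≈0 y≉0 xy≈0 = x≉0∧x*y≈0⇒y≈0 y≉0 (trans (*-comm _ _) xy≈0)

    x*y≉0 : ∀ {x y} → x ≉ 0# → y ≉ 0# → x * y ≉ 0#
    x*y≉0 x≉0 y≉0 xy≈0 = y≉0 (x≉0∧x*y≈0⇒y≈0 x≉0 xy≈0)

    x^k≉0 : ¬ 0# ≈ 1# → ∀ {x} k → x ≉ 0# → x ^ k ≉ 0#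
    x^k≉0 0≉1 zero    x≉0 1≈0 = 0≉1 (sym 1≈0)
    x^k≉0 0≉1 (suc k) x≉0     = x*y≉0 x≉0 (x^k≉0 0≉1 k x≉0)

    ∏≉0 : ¬ 0# ≈ 1# → ∀ {k} (f : Fin k → Carrier) → (∀ j → f j ≉ 0#) → Π.sum f ≉ 0#
    ∏≉0 0≉1 {zero}  f f≉0 1≈0 = 0≉1 (sym 1≈0)
    ∏≉0 0≉1 {suc k} f f≉0     = x*y≉0 (f≉0 zero) (∏≉0 0≉1 (tail f) (f≉0 ∘ suc))

module Polynomials (R : CommutativeRing 0ℓ 0ℓ) where
  open CommutativeRing R hiding (zero)
  open import Relation.Binary.Reasoning.Setoid setoid
  open import Algebra.Solver.Ring.NaturalCoefficients.Default commutativeSemiring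
  open import Algebra.Properties.Semiring.Exp semiring using (_^_)
  open import Algebra.Properties.Group +-group using (//-rightDividesˡ; x∙y⁻¹≈ε⇒x≈y)
  open import Algebra.Properties.CommutativeSemigroup *-commutativeSemigroup using (x∙yz≈y∙xz)
  import Algebra.Properties.CommutativeMonoid.Sum +-commutativeMonoid as Σ

  eval : ∀ {n} → Vector Carrier n → Carrier → Carrier
  eval {zero}  c x = 0#
  eval {suc n} c x = head c + x * eval (tail c) x

  eval-zero : ∀ {n} (c : Vector Carrier n) x → (∀ i → c i ≈ 0#) → eval c x ≈ 0#
  eval-zero {zero}  c x c≈0 = refl
  eval-zero {suc n} c x c≈0 = begin
    head c + x * eval (tail c) x  ≈⟨ +-cong (c≈0 zero) (*-congˡ (eval-zero (tail c) x (c≈0 ∘ suc))) ⟩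
    0# + x * 0#                   ≈⟨ +-identityˡ _ ⟩
    x * 0#                        ≈⟨ zeroʳ x ⟩
    0#                            ∎

  quotient : ∀ {n} → Carrier → Vector Carrier (suc n) → Vector Carrier n
  quotient r c zero    = eval (tail c) r
  quotient r c (suc i) = quotient r (tail c) i

  -- Rewriting one x as (x - r) + r turns the inductive step into a semiring identity.
  eval-factor : ∀ {n} (c : Vector Carrier (suc n)) x r →
                eval c x ≈ eval c r + (x - r) * eval (quotient r c) x
  eval-factor {zero} c x r =
    solve 4 (λ c₀ x r u → c₀ :+ x :* con 0 := (c₀ :+ r :* con 0) :+ u :* con 0) refl (head c) x r (x - r)
  eval-factor {suc n} c x r = begin
    c₀ + x * T x                        ≈⟨ +-congˡ (*-congˡ (eval-factor t x r)) ⟩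
    c₀ + x * (T r + u * D)              ≈⟨ solve 5 (λ c₀ x Tr u D →
                                             c₀ :+ x :* (Tr :+ u :* D) := (c₀ :+ x :* Tr) :+ u :* (x :* D))
                                           refl c₀ x (T r) u D ⟩
    (c₀ + x * T r) + u * (x * D)        ≈⟨ +-congʳ (+-congˡ (*-congʳ (sym (//-rightDividesˡ r x)))) ⟩
    (c₀ + (u + r) * T r) + u * (x * D)  ≈⟨ solve 6 (λ c₀ x r Tr u D →
                                             (c₀ :+ (u :+ r) :* Tr) :+ u :* (x :* D)
                                             := (c₀ :+ r :* Tr) :+ u :* (Tr :+ x :* D))
                                           refl c₀ x r (T r) u D ⟩
    (c₀ + r * T r) + u * (T r + x * D)  ∎
    where
    c₀ = head c
    t  = tail c
    T  = eval t
    u  = x - r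
    D  = eval (quotient r t) x

  eval-+ : ∀ {n} (c d : Vector Carrier n) x → eval (λ i → c i + d i) x ≈ eval c x + eval d x
  eval-+ {zero}  c d x = sym (+-identityˡ 0#)
  eval-+ {suc n} c d x = begin
    (c₀ + d₀) + x * eval (λ i → tail c i + tail d i) x  ≈⟨ +-congˡ (*-congˡ (eval-+ (tail c) (tail d) x)) ⟩
    (c₀ + d₀) + x * (C + D)
      ≈⟨ solve 5 (λ c₀ d₀ x C D → (c₀ :+ d₀) :+ x :* (C :+ D) := (c₀ :+ x :* C) :+ (d₀ :+ x :* D)) refl c₀ d₀ x C D ⟩
    (c₀ + x * C) + (d₀ + x * D)                         ∎
    where
    c₀ = head c
    d₀ = head d
    C  = eval (tail c) x
    D  = eval (tail d) x

  eval-sum : ∀ {k n} (c : Fin k → Vector Carrier n) x →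
             eval (λ i → Σ.sum (λ j → c j i)) x ≈ Σ.sum (λ j → eval (c j) x)
  eval-sum {zero} {n} c x = eval-zero {n} _ x (λ i → refl)
  eval-sum {suc k} c x = trans (eval-+ (c zero) _ x) (+-congˡ (eval-sum (c ∘ suc) x))

  monomial : ∀ {n} → Carrier → Fin n → Vector Carrier n
  monomial a zero    zero    = a
  monomial a zero    (suc i) = 0#
  monomial a (suc e) zero    = 0#
  monomial a (suc e) (suc i) = monomial a e i

  monomial-≡ : ∀ {n} a (e : Fin n) → monomial a e e ≈ a
  monomial-≡ a zero    = refl
  monomial-≡ a (suc e) = monomial-≡ a e

  monomial-≢ : ∀ {n} a {e i : Fin n} → i ≢ e → monomial a e i ≈ 0#
  monomial-≢ a {zero}  {zero}  i≢e = ⊥-elim (i≢e ≡.refl)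
  monomial-≢ a {zero}  {suc i} i≢e = refl
  monomial-≢ a {suc e} {zero}  i≢e = refl
  monomial-≢ a {suc e} {suc i} i≢e = monomial-≢ a (λ i≡e → i≢e (≡.cong suc i≡e))

  eval-monomial : ∀ {n} a (e : Fin n) x → eval (monomial a e) x ≈ a * x ^ toℕ e
  eval-monomial {suc n} a zero x = begin
    a + x * eval {n} (λ _ → 0#) x  ≈⟨ +-congˡ (trans (*-congˡ (eval-zero {n} _ x (λ _ → refl))) (zeroʳ x)) ⟩
    a + 0#                         ≈⟨ +-identityʳ a ⟩
    a                              ≈⟨ sym (*-identityʳ a) ⟩
    a * 1#                         ∎
  eval-monomial {suc n} a (suc e) x = begin
    0# + x * eval (monomial a e) x ≈⟨ +-identityˡ _ ⟩
    x * eval (monomial a e) x      ≈⟨ *-congˡ (eval-monomial a e x) ⟩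
    x * (a * x ^ toℕ e)            ≈⟨ x∙yz≈y∙xz x a _ ⟩
    a * (x * x ^ toℕ e)            ∎

  eval-tail-root : ∀ {n} (c : Vector Carrier (suc n)) r →
                   (∀ i → quotient r c i ≈ 0#) → eval (tail c) r ≈ 0#
  eval-tail-root {zero}  c r q≈0 = refl
  eval-tail-root {suc n} c r q≈0 = q≈0 zero

  quotient≈0⇒≈0 : ∀ {n} (c : Vector Carrier (suc n)) r → eval c r ≈ 0# →
                  (∀ i → quotient r c i ≈ 0#) → ∀ i → c i ≈ 0#
  quotient≈0⇒≈0 c r c[r]≈0 q≈0 zero = begin
    head c                        ≈⟨ sym (+-identityʳ _) ⟩
    head c + 0#                   ≈⟨ +-congˡ (sym (trans (*-congˡ (eval-tail-root c r q≈0)) (zeroʳ r))) ⟩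
    head c + r * eval (tail c) r  ≈⟨ c[r]≈0 ⟩
    0#                            ∎
  quotient≈0⇒≈0 {suc n} c r c[r]≈0 q≈0 (suc i) =
    quotient≈0⇒≈0 (tail c) r (q≈0 zero) (q≈0 ∘ suc) i

  module _ (inverse : ∀ x → x ≉ 0# → ∃ λ y → x * y ≈ 1#) where
    open FieldProperties R using (x≉0∧x*y≈0⇒y≈0)

    roots⇒≈0 : ∀ {n} (c : Vector Carrier n) (r : Fin n → Carrier) →
               (∀ i j → r i ≈ r j → i ≡ j) → (∀ i → eval c (r i) ≈ 0#) → ∀ i → c i ≈ 0#
    roots⇒≈0 {suc n} c r r-inj roots = quotient≈0⇒≈0 c r₀ (roots zero)
      (roots⇒≈0 (quotient r₀ c) (r ∘ suc) (λ i j → Fin.suc-injective ∘ r-inj (suc i) (suc j)) quotient-roots)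
      where
      r₀ = r zero
      quotient-roots : ∀ i → eval (quotient r₀ c) (r (suc i)) ≈ 0#
      quotient-roots i = x≉0∧x*y≈0⇒y≈0 inverse rᵢ-r₀≉0 (begin
        (rᵢ - r₀) * Q                ≈⟨ sym (+-identityˡ _) ⟩
        0# + (rᵢ - r₀) * Q           ≈⟨ +-congʳ (sym (roots zero)) ⟩
        eval c r₀ + (rᵢ - r₀) * Q    ≈⟨ sym (eval-factor c rᵢ r₀) ⟩
        eval c rᵢ                    ≈⟨ roots (suc i) ⟩
        0#                           ∎)
        where
        rᵢ = r (suc i)
        Q  = eval (quotient r₀ c) rᵢ
        rᵢ-r₀≉0 : rᵢ - r₀ ≉ 0#
        rᵢ-r₀≉0 rᵢ-r₀≈0 with () ← r-inj (suc i) zero (x∙y⁻¹≈ε⇒x≈y _ _ rᵢ-r₀≈0)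

module FiniteFields (R : CommutativeRing 0ℓ 0ℓ) where
  open CommutativeRing R hiding (zero)
  open FieldProperties R
  open import Relation.Binary.Reasoning.Setoid setoid
  open import Algebra.Properties.Semiring.Exp semiring using (_^_)
  import Algebra.Properties.CommutativeMonoid.Sum *-commutativeMonoid as Π
  import Data.Fin.Permutation as Perm
  open import Algebra.Properties.Ring ring using (-1*x≈-x; -‿involutive)

  module Enumeration {n} (F : IsFiniteFieldOfOrder R n) where
    open IsFiniteFieldOfOrder F

    index : Carrier → Fin n
    index x = proj₁ (enum-sur x)

    enum-index : ∀ x → enum (index x) ≈ x
    enum-index x = proj₂ (enum-sur x)

    index-injective : ∀ {x y} → index x ≡ index y → x ≈ y
    index-injective {x} {y} iₓ≡iᵧ = begin
      x              ≈⟨ sym (enum-index x) ⟩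
      enum (index x) ≡⟨ ≡.cong enum iₓ≡iᵧ ⟩
      enum (index y) ≈⟨ enum-index y ⟩
      y              ∎

    index-enum : ∀ i → index (enum i) ≡ i
    index-enum i = enum-inj _ _ (enum-index (enum i))

    index-cong : ∀ {x y} → x ≈ y → index x ≡ index y
    index-cong {x} {y} x≈y = enum-inj _ _ (trans (enum-index x) (trans x≈y (sym (enum-index y))))

    ≈0? : ∀ x → Dec (x ≈ 0#)
    ≈0? x with index x Fin.≟ index 0#
    ... | yes iₓ≡i₀ = yes (index-injective iₓ≡i₀)
    ... | no iₓ≢i₀  = no (iₓ≢i₀ ∘ index-cong)

  module Units {m} (F : IsFiniteFieldOfOrder R (suc m)) where
    open IsFiniteFieldOfOrder F
    open Enumeration F

    unit : Fin m → Carrier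
    unit j = enum (punchIn (index 0#) j)

    unit≉0 : ∀ j → unit j ≉ 0#
    unit≉0 j uⱼ≈0 = Fin.punchInᵢ≢i (index 0#) j (≡.trans (≡.sym (index-enum _)) (index-cong uⱼ≈0))

    unit-injective : ∀ j k → unit j ≈ unit k → j ≡ k
    unit-injective j k uⱼ≈uₖ = Fin.punchIn-injective (index 0#) j k (enum-inj _ _ uⱼ≈uₖ)

    unit-index : ∀ {x} → x ≉ 0# → Fin m
    unit-index {x} x≉0 = punchOut {i = index 0#} {j = index x} (x≉0 ∘ index-injective ∘ ≡.sym)

    unit-unit-index : ∀ {x} (x≉0 : x ≉ 0#) → unit (unit-index x≉0) ≈ x
    unit-unit-index {x} x≉0 = trans (reflexive (≡.cong enum (Fin.punchIn-punchOut _))) (enum-index x)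

    scale : ∀ {x} → x ≉ 0# → Fin m → Fin m
    scale x≉0 j = unit-index (x*y≉0 inverse x≉0 (unit≉0 j))

    unit-scale : ∀ {x} (x≉0 : x ≉ 0#) j → unit (scale x≉0 j) ≈ x * unit j
    unit-scale x≉0 j = unit-unit-index (x*y≉0 inverse x≉0 (unit≉0 j))

    scale-inverse : ∀ {x y} (x≉0 : x ≉ 0#) (y≉0 : y ≉ 0#) → x * y ≈ 1# →
                    ∀ j → scale x≉0 (scale y≉0 j) ≡ j
    scale-inverse {x} {y} x≉0 y≉0 xy≈1 j = unit-injective _ _ (begin
      unit (scale x≉0 (scale y≉0 j)) ≈⟨ unit-scale x≉0 _ ⟩
      x * unit (scale y≉0 j)         ≈⟨ *-congˡ (unit-scale y≉0 j) ⟩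
      x * (y * unit j)               ≈⟨ sym (*-assoc x y _) ⟩
      (x * y) * unit j               ≈⟨ *-congʳ xy≈1 ⟩
      1# * unit j                    ≈⟨ *-identityˡ _ ⟩
      unit j                         ∎)

    scaling : ∀ {x y} → x * y ≈ 1# → Perm.Permutation m m
    scaling {x} {y} xy≈1 = Perm.permutation (scale x≉0) (scale y≉0)
      (scale-inverse x≉0 y≉0 xy≈1) (scale-inverse y≉0 x≉0 (trans (*-comm y x) xy≈1))
      where
      x≉0 = x*y≈1⇒x≉0 0≉1 xy≈1
      y≉0 = x*y≈1⇒y≉0 0≉1 xy≈1

    x^m≈1 : ∀ {x} → x ≉ 0# → x ^ m ≈ 1#
    x^m≈1 {x} x≉0 with inverse x x≉0
    ... | y , xy≈1 = *-cancelˡ inverse (∏≉0 inverse 0≉1 unit unit≉0) (begin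
      Π.sum unit * x ^ m                     ≈⟨ *-comm _ _ ⟩
      x ^ m * Π.sum unit                     ≈⟨ *-congʳ (sym (Π.sum-replicate m {x})) ⟩
      Π.sum {m} (λ _ → x) * Π.sum unit       ≈⟨ sym (Π.∑-distrib-+ (λ _ → x) unit) ⟩
      Π.sum (λ j → x * unit j)               ≈⟨ Π.sum-cong-≋ (λ j → sym (unit-scale x≉0 j)) ⟩
      Π.sum (λ j → unit (scale x≉0 j))       ≈⟨ sym (Π.sum-permute unit (scaling xy≈1)) ⟩
      Π.sum unit                             ≈⟨ sym (*-identityʳ _) ⟩
      Π.sum unit * 1#                        ∎)

  x^n≈x : ∀ {n} → IsFiniteFieldOfOrder R n → ∀ x → x ^ n ≈ x
  x^n≈x {zero}  F x with () ← Enumeration.index F x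
  x^n≈x {suc m} F x with Enumeration.≈0? F x
  ... | yes x≈0 = begin
    x * x ^ m  ≈⟨ *-congʳ x≈0 ⟩
    0# * x ^ m ≈⟨ zeroˡ _ ⟩
    0#         ≈⟨ sym x≈0 ⟩
    x          ∎
  ... | no x≉0 = trans (*-congˡ (Units.x^m≈1 F x≉0)) (*-identityʳ x)

  x^k≈0⇒x≈0 : ∀ {n} → IsFiniteFieldOfOrder R n → ∀ {x} k → x ^ k ≈ 0# → x ≈ 0#
  x^k≈0⇒x≈0 F {x} k x^k≈0 with Enumeration.≈0? F x
  ... | yes x≈0 = x≈0
  ... | no x≉0  = ⊥-elim (x^k≉0 inverse 0≉1 k x≉0 x^k≈0)
    where open IsFiniteFieldOfOrder F

  even-order⇒1+1≈0 : ∀ {n} → IsFiniteFieldOfOrder R n → 2 ∣ n → 1# + 1# ≈ 0#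
  even-order⇒1+1≈0 {n} F (divides k n≡k*2) = begin
    1# + 1#    ≈⟨ +-congˡ (sym -1≈1) ⟩
    1# + - 1#  ≈⟨ -‿inverseʳ 1# ⟩
    0#         ∎
    where
    [-1]²≈1 : (- 1#) * (- 1#) ≈ 1#
    [-1]²≈1 = trans (-1*x≈-x (- 1#)) (-‿involutive 1#)
    [-1]^[2k]≈1 : ∀ k → (- 1#) ^ (k ℕ.* 2) ≈ 1#
    [-1]^[2k]≈1 zero    = refl
    [-1]^[2k]≈1 (suc k) = begin
      (- 1#) * ((- 1#) * (- 1#) ^ (k ℕ.* 2))  ≈⟨ sym (*-assoc _ _ _) ⟩
      ((- 1#) * (- 1#)) * (- 1#) ^ (k ℕ.* 2)  ≈⟨ *-cong [-1]²≈1 ([-1]^[2k]≈1 k) ⟩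
      1# * 1#                                 ≈⟨ *-identityˡ 1# ⟩
      1#                                      ∎
    -1≈1 : - 1# ≈ 1#
    -1≈1 = begin
      - 1#                ≈⟨ sym (x^n≈x F (- 1#)) ⟩
      (- 1#) ^ n          ≡⟨ ≡.cong ((- 1#) ^_) n≡k*2 ⟩
      (- 1#) ^ (k ℕ.* 2)  ≈⟨ [-1]^[2k]≈1 k ⟩
      1#                  ∎

module CharacteristicTwo (R : CommutativeRing 0ℓ 0ℓ) where
  open CommutativeRing R hiding (zero)
  open import Relation.Binary.Reasoning.Setoid setoid
  open import Algebra.Solver.Ring.NaturalCoefficients.Default commutativeSemiring
  open import Algebra.Properties.Semiring.Exp semiring using (_^_; ^-congˡ; ^-assocʳ)

  module _ (1+1≈0 : 1# + 1# ≈ 0#) where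

    x+x≈0 : ∀ x → x + x ≈ 0#
    x+x≈0 x = begin
      x + x          ≈⟨ solve 1 (λ x → x :+ x := x :* (con 1 :+ con 1)) refl x ⟩
      x * (1# + 1#)  ≈⟨ *-congˡ 1+1≈0 ⟩
      x * 0#         ≈⟨ zeroʳ x ⟩
      0#             ∎

    x+y≈0⇒x≈y : ∀ {x y} → x + y ≈ 0# → x ≈ y
    x+y≈0⇒x≈y {x} {y} x+y≈0 = begin
      x            ≈⟨ sym (+-identityʳ x) ⟩
      x + 0#       ≈⟨ +-congˡ (sym (x+x≈0 y)) ⟩
      x + (y + y)  ≈⟨ sym (+-assoc x y y) ⟩
      (x + y) + y  ≈⟨ +-congʳ x+y≈0 ⟩
      0# + y       ≈⟨ +-identityˡ y ⟩
      y            ∎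

    [x+y]²≈x²+y² : ∀ x y → (x + y) ^ 2 ≈ x ^ 2 + y ^ 2
    [x+y]²≈x²+y² x y = begin
      (x + y) ^ 2                        ≈⟨ solve 2 (λ x y → (x :+ y) :* ((x :+ y) :* con 1)
                                                       := (x :* (x :* con 1) :+ y :* (y :* con 1)) :+ (x :* y :+ x :* y))
                                             refl x y ⟩
      (x ^ 2 + y ^ 2) + (x * y + x * y)  ≈⟨ +-congˡ (x+x≈0 (x * y)) ⟩
      (x ^ 2 + y ^ 2) + 0#               ≈⟨ +-identityʳ _ ⟩
      x ^ 2 + y ^ 2                      ∎

    [x+y]^2^k≈x^2^k+y^2^k : ∀ k x y → (x + y) ^ (2 ℕ.^ k) ≈ x ^ (2 ℕ.^ k) + y ^ (2 ℕ.^ k)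
    [x+y]^2^k≈x^2^k+y^2^k zero    x y = distribʳ 1# x y
    [x+y]^2^k≈x^2^k+y^2^k (suc k) x y = begin
      (x + y) ^ (2 ℕ.* 2ᵏ)          ≈⟨ sym (^-assocʳ (x + y) 2 2ᵏ) ⟩
      ((x + y) ^ 2) ^ 2ᵏ            ≈⟨ ^-congˡ 2ᵏ ([x+y]²≈x²+y² x y) ⟩
      (x ^ 2 + y ^ 2) ^ 2ᵏ          ≈⟨ [x+y]^2^k≈x^2^k+y^2^k k (x ^ 2) (y ^ 2) ⟩
      (x ^ 2) ^ 2ᵏ + (y ^ 2) ^ 2ᵏ   ≈⟨ +-cong (^-assocʳ x 2 2ᵏ) (^-assocʳ y 2 2ᵏ) ⟩
      x ^ (2 ℕ.* 2ᵏ) + y ^ (2 ℕ.* 2ᵏ) ∎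
      where
      2ᵏ : ℕ
      2ᵏ = 2 ℕ.^ k

module Frobenius (R : CommutativeRing 0ℓ 0ℓ) {h m : ℕ} (1≤h : 1 ≤ h)
         (F : IsFiniteFieldOfOrder R ((2 ℕ.^ h) ℕ.^ suc m)) where
  open CommutativeRing R hiding (zero)
  open import Relation.Binary.Reasoning.Setoid setoid
  open import Algebra.Properties.Semiring.Exp semiring using (_^_; ^-congˡ; ^-assocʳ)
  open import Algebra.Properties.CommutativeSemiring.Exp commutativeSemiring using (^-distrib-*)
  open import Algebra.Properties.Semiring.Sum semiring using (sum)
  open FiniteFields R using (x^n≈x; x^k≈0⇒x≈0; even-order⇒1+1≈0)
  open CharacteristicTwo R

  q : ℕ
  q = 2 ℕ.^ h

  open FieldDefs R q public using (pow; fr)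

  pow≡^ : ∀ x n → pow x n ≡ x ^ n
  pow≡^ x zero    = ≡.refl
  pow≡^ x (suc n) = ≡.cong (x *_) (pow≡^ x n)

  fr≈^ : ∀ k x → fr k x ≈ x ^ (q ℕ.^ k)
  fr≈^ k x = reflexive (pow≡^ x (q ℕ.^ k))

  1+1≈0 : 1# + 1# ≈ 0#
  1+1≈0 = even-order⇒1+1≈0 F (∣m⇒∣m*n (q ℕ.^ m) (2∣2^h 1≤h))

  fr-cong : ∀ k {x y} → x ≈ y → fr k x ≈ fr k y
  fr-cong k {x} {y} x≈y = begin
    fr k x         ≈⟨ fr≈^ k x ⟩
    x ^ (q ℕ.^ k)  ≈⟨ ^-congˡ (q ℕ.^ k) x≈y ⟩
    y ^ (q ℕ.^ k)  ≈⟨ sym (fr≈^ k y) ⟩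
    fr k y         ∎

  fr-+ : ∀ k x y → fr k (x + y) ≈ fr k x + fr k y
  fr-+ k x y = begin
    fr k (x + y)                                   ≈⟨ fr≈^ k (x + y) ⟩
    (x + y) ^ (q ℕ.^ k)                            ≡⟨ ≡.cong ((x + y) ^_) q^k≡2^hk ⟩
    (x + y) ^ (2 ℕ.^ (h ℕ.* k))                    ≈⟨ [x+y]^2^k≈x^2^k+y^2^k 1+1≈0 (h ℕ.* k) x y ⟩
    x ^ (2 ℕ.^ (h ℕ.* k)) + y ^ (2 ℕ.^ (h ℕ.* k))  ≡⟨ ≡.cong (λ e → x ^ e + y ^ e) (≡.sym q^k≡2^hk) ⟩
    x ^ (q ℕ.^ k) + y ^ (q ℕ.^ k)                  ≈⟨ sym (+-cong (fr≈^ k x) (fr≈^ k y)) ⟩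
    fr k x + fr k y                                ∎
    where
    q^k≡2^hk : q ℕ.^ k ≡ 2 ℕ.^ (h ℕ.* k)
    q^k≡2^hk = ℕ.^-*-assoc 2 h k

  fr-* : ∀ k x y → fr k (x * y) ≈ fr k x * fr k y
  fr-* k x y = begin
    fr k (x * y)                   ≈⟨ fr≈^ k (x * y) ⟩
    (x * y) ^ (q ℕ.^ k)            ≈⟨ ^-distrib-* x y (q ℕ.^ k) ⟩
    x ^ (q ℕ.^ k) * y ^ (q ℕ.^ k)  ≈⟨ sym (*-cong (fr≈^ k x) (fr≈^ k y)) ⟩
    fr k x * fr k y                ∎

  fr-0# : ∀ k → fr k 0# ≈ 0#
  fr-0# k = begin
    fr k 0#            ≈⟨ fr-cong k (sym (+-identityʳ 0#)) ⟩
    fr k (0# + 0#)     ≈⟨ fr-+ k 0# 0# ⟩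
    fr k 0# + fr k 0#  ≈⟨ x+x≈0 1+1≈0 (fr k 0#) ⟩
    0#                 ∎

  fr≈0⇒≈0 : ∀ k {x} → fr k x ≈ 0# → x ≈ 0#
  fr≈0⇒≈0 k {x} frₖx≈0 = x^k≈0⇒x≈0 F (q ℕ.^ k) (trans (sym (fr≈^ k x)) frₖx≈0)

  fr-zero : ∀ x → fr 0 x ≈ x
  fr-zero x = *-identityʳ x

  fr-suc : ∀ k x → fr (suc k) x ≈ fr 1 (fr k x)
  fr-suc k x = begin
    fr (suc k) x                    ≈⟨ fr≈^ (suc k) x ⟩
    x ^ (q ℕ.^ suc k)               ≡⟨ ≡.cong (x ^_) q^[1+k]≡q^k*q^1 ⟩
    x ^ (q ℕ.^ k ℕ.* q ℕ.^ 1)       ≈⟨ sym (^-assocʳ x (q ℕ.^ k) (q ℕ.^ 1)) ⟩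
    (x ^ (q ℕ.^ k)) ^ (q ℕ.^ 1)     ≈⟨ sym (trans (fr≈^ 1 (fr k x)) (^-congˡ (q ℕ.^ 1) (fr≈^ k x))) ⟩
    fr 1 (fr k x)                   ∎
    where
    q^[1+k]≡q^k*q^1 : q ℕ.^ suc k ≡ q ℕ.^ k ℕ.* q ℕ.^ 1
    q^[1+k]≡q^k*q^1 = ≡.trans (≡.cong (q ℕ.^_) (ℕ.+-comm 1 k)) (ℕ.^-distribˡ-+-* q k 1)

  fr-period : ∀ x → fr (suc m) x ≈ x
  fr-period x = trans (fr≈^ (suc m) x) (x^n≈x F x)

  fr-sum : ∀ k {n} (v : Vector Carrier n) → fr k (sum v) ≈ sum (λ i → fr k (v i))
  fr-sum k {zero}  v = fr-0# k
  fr-sum k {suc n} v = trans (fr-+ k (v zero) _) (+-congˡ (fr-sum k (tail v)))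

  φ : Carrier → Carrier
  φ = fr 1

  -- Unlike fr k, the k-fold composite is what the coefficients of rotate^[ k ] below compute to.
  φ^[_] : ℕ → Carrier → Carrier
  φ^[ zero ]  x = x
  φ^[ suc k ] x = φ (φ^[ k ] x)

  fr≈φ^[] : ∀ k x → fr k x ≈ φ^[ k ] x
  fr≈φ^[] zero    x = fr-zero x
  fr≈φ^[] (suc k) x = trans (fr-suc k x) (fr-cong 1 (fr≈φ^[] k x))

  φ^[]-cong : ∀ k {x y} → x ≈ y → φ^[ k ] x ≈ φ^[ k ] y
  φ^[]-cong k {x} {y} x≈y = trans (sym (fr≈φ^[] k x)) (trans (fr-cong k x≈y) (fr≈φ^[] k y))

  φ^[]-0# : ∀ k → φ^[ k ] 0# ≈ 0#
  φ^[]-0# k = trans (sym (fr≈φ^[] k 0#)) (fr-0# k)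

  φ^[]≈0⇒≈0 : ∀ k {x} → φ^[ k ] x ≈ 0# → x ≈ 0#
  φ^[]≈0⇒≈0 k {x} φᵏx≈0 = fr≈0⇒≈0 k (trans (fr≈φ^[] k x) φᵏx≈0)

  φ^[]-* : ∀ k x y → φ^[ k ] (x * y) ≈ φ^[ k ] x * φ^[ k ] y
  φ^[]-* k x y = begin
    φ^[ k ] (x * y)          ≈⟨ sym (fr≈φ^[] k (x * y)) ⟩
    fr k (x * y)             ≈⟨ fr-* k x y ⟩
    fr k x * fr k y          ≈⟨ *-cong (fr≈φ^[] k x) (fr≈φ^[] k y) ⟩
    φ^[ k ] x * φ^[ k ] y    ∎

  φ^[]-period : ∀ x → φ^[ suc m ] x ≈ x
  φ^[]-period x = trans (sym (fr≈φ^[] (suc m) x)) (fr-period x)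

module LinearisedPolynomials (R : CommutativeRing 0ℓ 0ℓ) {h m : ℕ} (1≤h : 1 ≤ h)
         (F : IsFiniteFieldOfOrder R ((2 ℕ.^ h) ℕ.^ suc m)) where
  open CommutativeRing R hiding (zero)
  open IsFiniteFieldOfOrder F
  open import Relation.Binary.Reasoning.Setoid setoid
  open import Algebra.Properties.Semiring.Exp semiring using (_^_)
  open import Algebra.Properties.Semiring.Sum semiring using (sum; sum-cong-≋; sum-init-last; ∑-distrib-+; *-distribˡ-sum)
  open CharacteristicTwo R using (x+x≈0; x+y≈0⇒x≈y)
  open Polynomials R using (eval; eval-sum; monomial; monomial-≡; monomial-≢; eval-monomial; roots⇒≈0)
  open SumProperties +-commutativeMonoid using (sum-single)
  open Frobenius R {h} {m} 1≤h F

  ⟦_⟧ : Vector Carrier (suc m) → Carrier → Carrier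
  ⟦ L ⟧ y = sum (λ k → L k * fr (toℕ k) y)

  ⟦⟧-+ : ∀ L M y → ⟦ (λ k → L k + M k) ⟧ y ≈ ⟦ L ⟧ y + ⟦ M ⟧ y
  ⟦⟧-+ L M y = trans (sum-cong-≋ {x = λ k → (L k + M k) * fr (toℕ k) y} (λ k → distribʳ _ (L k) (M k)))
                     (∑-distrib-+ (λ k → L k * fr (toℕ k) y) (λ k → M k * fr (toℕ k) y))

  ⟦⟧-scale : ∀ c L y → ⟦ (λ k → c * L k) ⟧ y ≈ c * ⟦ L ⟧ y
  ⟦⟧-scale c L y = begin
    sum (λ k → (c * L k) * fr (toℕ k) y)
      ≈⟨ sum-cong-≋ {x = λ k → (c * L k) * fr (toℕ k) y} (λ k → *-assoc c (L k) _) ⟩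
    sum (λ k → c * (L k * fr (toℕ k) y))  ≈⟨ sym (*-distribˡ-sum c (λ k → L k * fr (toℕ k) y)) ⟩
    c * ⟦ L ⟧ y                           ∎

  rotate : Vector Carrier (suc m) → Vector Carrier (suc m)
  rotate L zero    = φ (L (Fin.fromℕ m))
  rotate L (suc i) = φ (L (Fin.inject₁ i))

  ⟦rotate⟧ : ∀ L y → ⟦ rotate L ⟧ y ≈ φ (⟦ L ⟧ y)
  ⟦rotate⟧ L y = sym (begin
    φ (⟦ L ⟧ y)                                          ≈⟨ fr-sum 1 (λ k → L k * fr (toℕ k) y) ⟩
    sum (λ k → φ (L k * fr (toℕ k) y))                   ≈⟨ sum-cong-≋ {x = λ k → φ (L k * fr (toℕ k) y)} φ-term ⟩
    sum g                                                ≈⟨ sum-init-last g ⟩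
    sum {m} (λ i → g (Fin.inject₁ i)) + g (Fin.fromℕ m)
                                                         ≈⟨ +-cong (sum-cong-≋ {x = g ∘ Fin.inject₁} g-inject₁) g-fromℕ ⟩
    sum {m} (λ i → rotate L (suc i) * fr (toℕ (suc i)) y) + rotate L zero * fr 0 y
                                                         ≈⟨ +-comm _ _ ⟩
    ⟦ rotate L ⟧ y                                       ∎)
    where
    g : Vector Carrier (suc m)
    g k = φ (L k) * fr (suc (toℕ k)) y
    φ-term : ∀ k → φ (L k * fr (toℕ k) y) ≈ g k
    φ-term k = trans (fr-* 1 _ _) (*-congˡ (sym (fr-suc (toℕ k) y)))
    g-inject₁ : ∀ i → g (Fin.inject₁ i) ≈ rotate L (suc i) * fr (toℕ (suc i)) y
    g-inject₁ i = *-congˡ (reflexive (≡.cong (λ k → fr (suc k) y) (Fin.toℕ-inject₁ i)))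
    g-fromℕ : g (Fin.fromℕ m) ≈ rotate L zero * fr 0 y
    g-fromℕ = *-congˡ (begin
      fr (suc (toℕ (Fin.fromℕ m))) y  ≡⟨ ≡.cong (λ k → fr (suc k) y) (Fin.toℕ-fromℕ m) ⟩
      fr (suc m) y                    ≈⟨ fr-period y ⟩
      y                               ≈⟨ sym (fr-zero y) ⟩
      fr 0 y                          ∎)

  rotate^[_] : ℕ → Vector Carrier (suc m) → Vector Carrier (suc m)
  rotate^[ zero ]  L = L
  rotate^[ suc k ] L = rotate (rotate^[ k ] L)

  ⟦rotate^[]⟧ : ∀ k L y → ⟦ rotate^[ k ] L ⟧ y ≈ fr k (⟦ L ⟧ y)
  ⟦rotate^[]⟧ zero    L y = sym (fr-zero _)
  ⟦rotate^[]⟧ (suc k) L y = begin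
    ⟦ rotate (rotate^[ k ] L) ⟧ y  ≈⟨ ⟦rotate⟧ (rotate^[ k ] L) y ⟩
    φ (⟦ rotate^[ k ] L ⟧ y)       ≈⟨ fr-cong 1 (⟦rotate^[]⟧ k L y) ⟩
    φ (fr k (⟦ L ⟧ y))             ≈⟨ sym (fr-suc k _) ⟩
    fr (suc k) (⟦ L ⟧ y)           ∎

  private
    N : ℕ
    N = suc (q ℕ.^ m)

    instance
      q≢0 : ℕ.NonZero q
      q≢0 = ℕ.m^n≢0 2 h

    1<q : 1 ℕ.< q
    1<q = ℕ.^-monoʳ-≤ 2 1≤h

    N≤q^[1+m] : N ≤ q ℕ.^ suc m
    N≤q^[1+m] = 1+q^m≤q^[1+m] m 1<q

    q^k<N : ∀ (k : Fin (suc m)) → q ℕ.^ toℕ k ℕ.< N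
    q^k<N k = s≤s (ℕ.^-monoʳ-≤ q (Fin.toℕ≤pred[n] k))

    exponent : Fin (suc m) → Fin N
    exponent k = Fin.fromℕ< (q^k<N k)

    exponent-injective : ∀ i k → exponent i ≡ exponent k → i ≡ k
    exponent-injective i k eᵢ≡eₖ = Fin.toℕ-injective
      (^-injectiveʳ 1<q (Fin.fromℕ<-injective _ _ (q^k<N i) (q^k<N k) eᵢ≡eₖ))

    asPolynomial : Vector Carrier (suc m) → Vector Carrier N
    asPolynomial L j = sum (λ k → monomial (L k) (exponent k) j)

    eval-asPolynomial : ∀ L y → eval (asPolynomial L) y ≈ ⟦ L ⟧ y
    eval-asPolynomial L y = begin
      eval (asPolynomial L) y
        ≈⟨ eval-sum (λ k → monomial (L k) (exponent k)) y ⟩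
      sum (λ k → eval (monomial (L k) (exponent k)) y)
        ≈⟨ sum-cong-≋ {x = λ k → eval (monomial (L k) (exponent k)) y} (λ k → eval-monomial (L k) (exponent k) y) ⟩
      sum (λ k → L k * y ^ toℕ (exponent k))
        ≈⟨ sum-cong-≋ {x = λ k → L k * y ^ toℕ (exponent k)} (λ k → *-congˡ (y^exponent k)) ⟩
      ⟦ L ⟧ y
        ∎
      where
      y^exponent : ∀ k → y ^ toℕ (exponent k) ≈ fr (toℕ k) y
      y^exponent k = trans (reflexive (≡.cong (y ^_) (Fin.toℕ-fromℕ< (q^k<N k)))) (sym (fr≈^ (toℕ k) y))

    asPolynomial-exponent : ∀ L i → asPolynomial L (exponent i) ≈ L i
    asPolynomial-exponent L i = trans
      (sum-single (λ k → monomial (L k) (exponent k) (exponent i)) i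
         (λ k k≢i → monomial-≢ (L k) (k≢i ∘ exponent-injective k i ∘ ≡.sym)))
      (monomial-≡ (L i) (exponent i))

  -- As an ordinary polynomial ⟦ L ⟧ has degree ≤ q^m, yet every element of the field is a root.
  ⟦⟧≈0⇒≈0 : ∀ L → (∀ y → ⟦ L ⟧ y ≈ 0#) → ∀ i → L i ≈ 0#
  ⟦⟧≈0⇒≈0 L L≈0 i = trans (sym (asPolynomial-exponent L i))
    (roots⇒≈0 inverse (asPolynomial L) point point-injective (λ j → trans (eval-asPolynomial L _) (L≈0 _))
              (exponent i))
    where
    point : Fin N → Carrier
    point j = enum (Fin.inject≤ j N≤q^[1+m])
    point-injective : ∀ j k → point j ≈ point k → j ≡ k
    point-injective j k pⱼ≈pₖ = Fin.inject≤-injective N≤q^[1+m] N≤q^[1+m] j k (enum-inj _ _ pⱼ≈pₖ)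

  ⟦⟧-injective : ∀ L M → (∀ y → ⟦ L ⟧ y ≈ ⟦ M ⟧ y) → ∀ i → L i ≈ M i
  ⟦⟧-injective L M L≈M i = x+y≈0⇒x≈y 1+1≈0 (⟦⟧≈0⇒≈0 (λ k → L k + M k) L+M≈0 i)
    where
    L+M≈0 : ∀ y → ⟦ (λ k → L k + M k) ⟧ y ≈ 0#
    L+M≈0 y = trans (⟦⟧-+ L M y) (trans (+-congʳ (L≈M y)) (x+x≈0 1+1≈0 (⟦ M ⟧ y)))

module GraphEquivalence (R : CommutativeRing 0ℓ 0ℓ) {h : ℕ} (1≤h : 1 ≤ h)
         (F : IsFiniteFieldOfOrder R ((2 ℕ.^ h) ℕ.^ 6)) where
  open CommutativeRing R hiding (zero)
  open IsFiniteFieldOfOrder F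
  open import Relation.Binary.Reasoning.Setoid setoid
  open import Algebra.Solver.Ring.NaturalCoefficients.Default commutativeSemiring using (solve; _:+_; _:*_; _:=_; con)
  open Frobenius R {h} {5} 1≤h F
  open LinearisedPolynomials R {h} {5} 1≤h F
  open FieldProperties R using (x≉0∧x*y≈0⇒y≈0; y≉0∧x*y≈0⇒x≈0; *-cancelˡ)
  open CharacteristicTwo R using (x+y≈0⇒x≈y)
  open FieldDefs R q using (N6/1; N6/3; U-bc; Graph; ΓLEquiv; GL2; FieldAut)
  open import Algebra.Properties.Semiring.Exp semiring using (_^_; ^-homo-*)

  trinomial : Carrier → Carrier → Carrier → Carrier
  trinomial b c x = fr 1 x + (b * fr 3 x + c * fr 5 x)

  record GLEquivalence (g : Carrier → Carrier) : Set where
    field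
      b c                : Carrier
      b≉0                : b ≉ 0#
      c≉0                : c ≉ 0#
      c≉b^[1+q²]         : c ≉ b * fr 2 b
      a β γ d            : Carrier
      det≉0              : a * d - β * γ ≉ 0#
      maps-into-graph    : ∀ y → γ * y + d * trinomial b c y ≈ g (a * y + β * trinomial b c y)

  module Automorphism (σ : FieldAut) where
    open FieldAut σ

    ρ-0 : ρ 0# ≈ 0#
    ρ-0 = begin
      ρ 0#                   ≈⟨ sym (+-identityʳ _) ⟩
      ρ 0# + 0#              ≈⟨ +-congˡ (sym (-‿inverseʳ (ρ 0#))) ⟩
      ρ 0# + (ρ 0# - ρ 0#)   ≈⟨ sym (+-assoc _ _ _) ⟩
      (ρ 0# + ρ 0#) - ρ 0#   ≈⟨ +-congʳ (sym (ρ-+ 0# 0#)) ⟩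
      ρ (0# + 0#) - ρ 0#     ≈⟨ +-congʳ (ρ-cong _ _ (+-identityʳ 0#)) ⟩
      ρ 0# - ρ 0#            ≈⟨ -‿inverseʳ _ ⟩
      0#                     ∎

    ρ-≉0 : ∀ {x} → x ≉ 0# → ρ x ≉ 0#
    ρ-≉0 x≉0 ρx≈0 = x≉0 (ρ-inj _ _ (trans ρx≈0 (sym ρ-0)))

    ρ-pow : ∀ x n → ρ (pow x n) ≈ pow (ρ x) n
    ρ-pow x zero    = ρ-1
    ρ-pow x (suc n) = trans (ρ-* _ _) (*-congˡ (ρ-pow x n))

    ρ-fr : ∀ k x → ρ (fr k x) ≈ fr k (ρ x)
    ρ-fr k x = ρ-pow x (q ℕ.^ k)

    ρ-trinomial : ∀ b c x → ρ (trinomial b c x) ≈ trinomial (ρ b) (ρ c) (ρ x)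
    ρ-trinomial b c x = begin
      ρ (fr 1 x + (b * fr 3 x + c * fr 5 x))            ≈⟨ ρ-+ _ _ ⟩
      ρ (fr 1 x) + ρ (b * fr 3 x + c * fr 5 x)          ≈⟨ +-congˡ (ρ-+ _ _) ⟩
      ρ (fr 1 x) + (ρ (b * fr 3 x) + ρ (c * fr 5 x))    ≈⟨ +-congˡ (+-cong (ρ-* _ _) (ρ-* _ _)) ⟩
      ρ (fr 1 x) + (ρ b * ρ (fr 3 x) + ρ c * ρ (fr 5 x))
        ≈⟨ +-cong (ρ-fr 1 x) (+-cong (*-congˡ (ρ-fr 3 x)) (*-congˡ (ρ-fr 5 x))) ⟩
      trinomial (ρ b) (ρ c) (ρ x)                               ∎

  trinomial-cong : ∀ b c {x y} → x ≈ y → trinomial b c x ≈ trinomial b c y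
  trinomial-cong b c x≈y = +-cong (fr-cong 1 x≈y) (+-cong (*-congˡ (fr-cong 3 x≈y)) (*-congˡ (fr-cong 5 x≈y)))

  pow[b,1+q²]≈b*fr2b : ∀ b → pow b (q ℕ.^ 2 ℕ.+ 1) ≈ b * fr 2 b
  pow[b,1+q²]≈b*fr2b b = begin
    pow b (q ℕ.^ 2 ℕ.+ 1)        ≡⟨ pow≡^ b (q ℕ.^ 2 ℕ.+ 1) ⟩
    b ^ (q ℕ.^ 2 ℕ.+ 1)          ≈⟨ ^-homo-* b (q ℕ.^ 2) 1 ⟩
    b ^ (q ℕ.^ 2) * b ^ 1        ≈⟨ *-cong (sym (fr≈^ 2 b)) (*-identityʳ b) ⟩
    fr 2 b * b                   ≈⟨ *-comm _ _ ⟩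
    b * fr 2 b                   ∎

  N6/1≉0⇒≉0 : ∀ {x} → N6/1 x ≉ 0# → x ≉ 0#
  N6/1≉0⇒≉0 Nx≉0 x≈0 = Nx≉0 (trans (*-congʳ x≈0) (zeroˡ _))

  N6/3≉0⇒≉0 : ∀ {x} → N6/3 x ≉ 0# → x ≉ 0#
  N6/3≉0⇒≉0 Nx≉0 x≈0 = Nx≉0 (trans (*-congʳ x≈0) (zeroˡ _))

  ΓLEquiv⇒GLEquivalence : ∀ {b c g} → b ≉ 0# → c ≉ 0# → c ≉ pow b (q ℕ.^ 2 ℕ.+ 1) →
                          (∀ {x y} → x ≈ y → g x ≈ g y) →
                          ΓLEquiv (U-bc b c) (Graph g) → GLEquivalence g
  ΓLEquiv⇒GLEquivalence {b} {c} {g} b≉0 c≉0 c≉b^[1+q²] g-cong (M , σ , into , _) = record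
    { b = b′ ; c = c′ ; b≉0 = ρ-≉0 b≉0 ; c≉0 = ρ-≉0 c≉0
    ; c≉b^[1+q²] = c≉b^[1+q²] ∘ ρ-inj _ _ ∘ flip trans b′*fr2b′≈ρ[b^[1+q²]]
    ; a = a₁₁ ; β = a₁₂ ; γ = a₂₁ ; d = a₂₂ ; det≉0 = det≉0
    ; maps-into-graph = maps-into-graph }
    where
    open GL2 M
    open FieldAut σ
    open Automorphism σ
    b′ c′ : Carrier
    b′ = ρ b
    c′ = ρ c
    b′*fr2b′≈ρ[b^[1+q²]] : b′ * fr 2 b′ ≈ ρ (pow b (q ℕ.^ 2 ℕ.+ 1))
    b′*fr2b′≈ρ[b^[1+q²]] = sym (trans (ρ-pow b (q ℕ.^ 2 ℕ.+ 1)) (pow[b,1+q²]≈b*fr2b b′))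
    maps-into-graph : ∀ y → a₂₁ * y + a₂₂ * trinomial b′ c′ y ≈ g (a₁₁ * y + a₁₂ * trinomial b′ c′ y)
    maps-into-graph y with ρ-sur y
    ... | x , ρx≈y with into (x , trinomial b c x) (x , refl , refl)
    ... | z , fst≈ , snd≈ = begin
      a₂₁ * y + a₂₂ * trinomial b′ c′ y          ≈⟨ sym (combination-cong a₂₁ a₂₂) ⟩
      a₂₁ * ρ x + a₂₂ * ρ (trinomial b c x)      ≈⟨ snd≈ ⟩
      g z                                        ≈⟨ g-cong (sym fst≈) ⟩
      g (a₁₁ * ρ x + a₁₂ * ρ (trinomial b c x))  ≈⟨ g-cong (combination-cong a₁₁ a₁₂) ⟩
      g (a₁₁ * y + a₁₂ * trinomial b′ c′ y)      ∎
      where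
      combination-cong : ∀ u v → u * ρ x + v * ρ (trinomial b c x) ≈ u * y + v * trinomial b′ c′ y
      combination-cong u v = +-cong (*-congˡ ρx≈y) (*-congˡ (trans (ρ-trinomial b c x) (trinomial-cong b′ c′ ρx≈y)))

  combination : Carrier → Carrier → Carrier → Carrier → Vector Carrier 6
  combination x₀ x₁ b c = x₀ ∷ x₁ ∷ 0# ∷ x₁ * b ∷ 0# ∷ x₁ * c ∷ []

  ⟦combination⟧ : ∀ x₀ x₁ b c y → ⟦ combination x₀ x₁ b c ⟧ y ≈ x₀ * y + x₁ * trinomial b c y
  ⟦combination⟧ x₀ x₁ b c y = begin
    ⟦ combination x₀ x₁ b c ⟧ y
      ≈⟨ solve 10 (λ x₀ x₁ b c y₀ y₁ y₂ y₃ y₄ y₅ →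
                    x₀ :* y₀ :+ (x₁ :* y₁ :+ (con 0 :* y₂ :+ ((x₁ :* b) :* y₃
                                                :+ (con 0 :* y₄ :+ ((x₁ :* c) :* y₅ :+ con 0)))))
                    := x₀ :* y₀ :+ x₁ :* (y₁ :+ (b :* y₃ :+ c :* y₅)))
                  refl x₀ x₁ b c (fr 0 y) (fr 1 y) (fr 2 y) (fr 3 y) (fr 4 y) (fr 5 y) ⟩
    x₀ * fr 0 y + x₁ * trinomial b c y  ≈⟨ +-congʳ (*-congˡ (fr-zero y)) ⟩
    x₀ * y + x₁ * trinomial b c y       ∎

  Represents : (Vector Carrier 6 → Vector Carrier 6) → (Carrier → Carrier) → Set
  Represents G g = ∀ L y → ⟦ G L ⟧ y ≈ g (⟦ L ⟧ y)

  module _ {g : Carrier → Carrier} (E : GLEquivalence g) where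
    open GLEquivalence E

    singular : β ≈ 0# → d ≈ 0# → ⊥
    singular β≈0 d≈0 = det≉0 (begin
      a * d - β * γ    ≈⟨ +-cong (*-congˡ d≈0) (-‿cong (*-congʳ β≈0)) ⟩
      a * 0# - 0# * γ  ≈⟨ +-cong (zeroʳ a) (-‿cong (zeroˡ γ)) ⟩
      0# - 0#          ≈⟨ -‿inverseʳ 0# ⟩
      0#               ∎)

    coefficient-identity : ∀ {G} → Represents G g → (∀ {x y} → x ≈ y → g x ≈ g y) →
                           ∀ i → combination γ d b c i ≈ G (combination a β b c) i
    coefficient-identity {G} G-represents g-cong = ⟦⟧-injective _ _ λ y → begin
      ⟦ combination γ d b c ⟧ y          ≈⟨ ⟦combination⟧ γ d b c y ⟩
      γ * y + d * trinomial b c y                ≈⟨ maps-into-graph y ⟩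
      g (a * y + β * trinomial b c y)            ≈⟨ g-cong (sym (⟦combination⟧ a β b c y)) ⟩
      g (⟦ combination a β b c ⟧ y)      ≈⟨ sym (G-represents _ y) ⟩
      ⟦ G (combination a β b c) ⟧ y      ∎

  binomial : Carrier → ℕ → ℕ → Vector Carrier 6 → Vector Carrier 6
  binomial δ s t L i = δ * rotate^[ s ] L i + rotate^[ t ] L i

  binomial-represents : ∀ δ s t → Represents (binomial δ s t) (λ x → δ * fr s x + fr t x)
  binomial-represents δ s t L y = begin
    ⟦ binomial δ s t L ⟧ y               ≈⟨ ⟦⟧-+ (λ i → δ * Lˢ i) Lᵗ y ⟩
    ⟦ (λ i → δ * Lˢ i) ⟧ y + ⟦ Lᵗ ⟧ y    ≈⟨ +-congʳ (⟦⟧-scale δ Lˢ y) ⟩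
    δ * ⟦ Lˢ ⟧ y + ⟦ Lᵗ ⟧ y              ≈⟨ +-cong (*-congˡ (⟦rotate^[]⟧ s L y)) (⟦rotate^[]⟧ t L y) ⟩
    δ * fr s (⟦ L ⟧ y) + fr t (⟦ L ⟧ y)  ∎
    where
    Lˢ Lᵗ : Vector Carrier 6
    Lˢ = rotate^[ s ] L
    Lᵗ = rotate^[ t ] L

  binomial-cong : ∀ δ s t {x y} → x ≈ y → δ * fr s x + fr t x ≈ δ * fr s y + fr t y
  binomial-cong δ s t x≈y = +-cong (*-congˡ (fr-cong s x≈y)) (fr-cong t x≈y)

  0≈x+y⇒x≈y : ∀ {x y} → 0# ≈ x + y → x ≈ y
  0≈x+y⇒x≈y 0≈x+y = x+y≈0⇒x≈y 1+1≈0 (sym 0≈x+y)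

  δφˢx+φᵗy≈0 : ∀ δ s t {x y} → x ≈ 0# → y ≈ 0# → δ * φ^[ s ] x + φ^[ t ] y ≈ 0#
  δφˢx+φᵗy≈0 δ s t {x} {y} x≈0 y≈0 = begin
    δ * φ^[ s ] x + φ^[ t ] y  ≈⟨ +-cong (*-congˡ (φ^[]-vanish s x≈0)) (φ^[]-vanish t y≈0) ⟩
    δ * 0# + 0#                ≈⟨ +-identityʳ _ ⟩
    δ * 0#                     ≈⟨ zeroʳ δ ⟩
    0#                         ∎
    where
    φ^[]-vanish : ∀ k {z} → z ≈ 0# → φ^[ k ] z ≈ 0#
    φ^[]-vanish k z≈0 = trans (φ^[]-cong k z≈0) (φ^[]-0# k)

  0≈δφˢx+φᵗ0⇒x≈0 : ∀ {δ} s t {x} → δ ≉ 0# → 0# ≈ δ * φ^[ s ] x + φ^[ t ] 0# → x ≈ 0#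
  0≈δφˢx+φᵗ0⇒x≈0 s t δ≉0 0≈δφˢx+φᵗ0 =
    φ^[]≈0⇒≈0 s (x≉0∧x*y≈0⇒y≈0 inverse δ≉0 (trans (0≈x+y⇒x≈y 0≈δφˢx+φᵗ0) (φ^[]-0# t)))

  0≈δφˢ0+φᵗx⇒x≈0 : ∀ δ s t {x} → 0# ≈ δ * φ^[ s ] 0# + φ^[ t ] x → x ≈ 0#
  0≈δφˢ0+φᵗx⇒x≈0 δ s t 0≈δφˢ0+φᵗx = φ^[]≈0⇒≈0 t (begin
    φ^[ t ] _             ≈⟨ sym (0≈x+y⇒x≈y 0≈δφˢ0+φᵗx) ⟩
    δ * φ^[ s ] 0#        ≈⟨ *-congˡ (φ^[]-0# s) ⟩
    δ * 0#                ≈⟨ zeroʳ δ ⟩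
    0#                    ∎)

  ¬GLEquivalence[x^q] : ¬ GLEquivalence (fr 1)
  ¬GLEquivalence[x^q] E = singular E β≈0 d≈0
    where
    open GLEquivalence E
    coefficient : ∀ i → combination γ d b c i ≈ rotate^[ 1 ] (combination a β b c) i
    coefficient = coefficient-identity E {rotate^[ 1 ]} (⟦rotate^[]⟧ 1) (fr-cong 1)
    coefficient₂ : 0# ≈ φ β
    coefficient₂ = coefficient (# 2)
    coefficient₃ : d * b ≈ φ 0#
    coefficient₃ = coefficient (# 3)
    β≈0 : β ≈ 0#
    β≈0 = fr≈0⇒≈0 1 (sym coefficient₂)
    d≈0 : d ≈ 0#
    d≈0 = y≉0∧x*y≈0⇒x≈0 inverse b≉0 (trans coefficient₃ (fr-0# 1))

  ¬GLEquivalence[x^q⁵] : ¬ GLEquivalence (fr 5)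
  ¬GLEquivalence[x^q⁵] E = singular E β≈0 d≈0
    where
    open GLEquivalence E
    coefficient : ∀ i → combination γ d b c i ≈ rotate^[ 5 ] (combination a β b c) i
    coefficient = coefficient-identity E {rotate^[ 5 ]} (⟦rotate^[]⟧ 5) (fr-cong 5)
    coefficient₁ : d ≈ φ^[ 5 ] 0#
    coefficient₁ = coefficient (# 1)
    coefficient₂ : 0# ≈ φ^[ 5 ] (β * b)
    coefficient₂ = coefficient (# 2)
    β≈0 : β ≈ 0#
    β≈0 = y≉0∧x*y≈0⇒x≈0 inverse b≉0 (φ^[]≈0⇒≈0 5 (sym coefficient₂))
    d≈0 : d ≈ 0#
    d≈0 = trans coefficient₁ (φ^[]-0# 5)

  ¬GLEquivalence[δx^q+x^q⁴] : ∀ {δ} → δ ≉ 0# → ¬ GLEquivalence (λ x → δ * fr 1 x + fr 4 x)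
  ¬GLEquivalence[δx^q+x^q⁴] {δ} δ≉0 E = singular E β≈0 d≈0
    where
    open GLEquivalence E
    coefficient : ∀ i → combination γ d b c i ≈ binomial δ 1 4 (combination a β b c) i
    coefficient = coefficient-identity E {binomial δ 1 4} (binomial-represents δ 1 4) (binomial-cong δ 1 4)
    coefficient₂ : 0# ≈ δ * φ^[ 1 ] β + φ^[ 4 ] 0#
    coefficient₂ = coefficient (# 2)
    coefficient₅ : d * c ≈ δ * φ^[ 1 ] 0# + φ^[ 4 ] β
    coefficient₅ = coefficient (# 5)
    β≈0 : β ≈ 0#
    β≈0 = 0≈δφˢx+φᵗ0⇒x≈0 1 4 δ≉0 coefficient₂
    d≈0 : d ≈ 0#
    d≈0 = y≉0∧x*y≈0⇒x≈0 inverse c≉0 (trans coefficient₅ (δφˢx+φᵗy≈0 δ 1 4 refl β≈0))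

  ¬GLEquivalence[δx^q²+x^q⁵] : ∀ {δ} → ¬ GLEquivalence (λ x → δ * fr 2 x + fr 5 x)
  ¬GLEquivalence[δx^q²+x^q⁵] {δ} E = singular E β≈0 d≈0
    where
    open GLEquivalence E
    coefficient : ∀ i → combination γ d b c i ≈ binomial δ 2 5 (combination a β b c) i
    coefficient = coefficient-identity E {binomial δ 2 5} (binomial-represents δ 2 5) (binomial-cong δ 2 5)
    coefficient₄ : 0# ≈ δ * φ^[ 2 ] 0# + φ^[ 5 ] (β * c)
    coefficient₄ = coefficient (# 4)
    coefficient₃ : d * b ≈ δ * φ^[ 2 ] β + φ^[ 5 ] 0#
    coefficient₃ = coefficient (# 3)
    β≈0 : β ≈ 0#
    β≈0 = y≉0∧x*y≈0⇒x≈0 inverse c≉0 (0≈δφˢ0+φᵗx⇒x≈0 δ 2 5 coefficient₄)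
    d≈0 : d ≈ 0#
    d≈0 = y≉0∧x*y≈0⇒x≈0 inverse b≉0 (trans coefficient₃ (δφˢx+φᵗy≈0 δ 2 5 β≈0 refl))

  ¬GLEquivalence[δx^q⁴+x^q⁷] : ∀ {δ} → ¬ GLEquivalence (λ x → δ * fr 4 x + fr 7 x)
  ¬GLEquivalence[δx^q⁴+x^q⁷] {δ} E = singular E β≈0 d≈0
    where
    open GLEquivalence E
    coefficient : ∀ i → combination γ d b c i ≈ binomial δ 4 7 (combination a β b c) i
    coefficient = coefficient-identity E {binomial δ 4 7} (binomial-represents δ 4 7) (binomial-cong δ 4 7)
    coefficient₂ : 0# ≈ δ * φ^[ 4 ] 0# + φ^[ 7 ] β
    coefficient₂ = coefficient (# 2)
    coefficient₅ : d * c ≈ δ * φ^[ 4 ] β + φ^[ 7 ] 0#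
    coefficient₅ = coefficient (# 5)
    β≈0 : β ≈ 0#
    β≈0 = 0≈δφˢ0+φᵗx⇒x≈0 δ 4 7 coefficient₂
    d≈0 : d ≈ 0#
    d≈0 = y≉0∧x*y≈0⇒x≈0 inverse c≉0 (trans coefficient₅ (δφˢx+φᵗy≈0 δ 4 7 β≈0 refl))

  ¬GLEquivalence[δx^q⁵+x^q⁸] : ∀ {δ} → δ ≉ 0# → ¬ GLEquivalence (λ x → δ * fr 5 x + fr 8 x)
  ¬GLEquivalence[δx^q⁵+x^q⁸] {δ} δ≉0 E = singular E β≈0 d≈0
    where
    open GLEquivalence E
    coefficient : ∀ i → combination γ d b c i ≈ binomial δ 5 8 (combination a β b c) i
    coefficient = coefficient-identity E {binomial δ 5 8} (binomial-represents δ 5 8) (binomial-cong δ 5 8)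
    coefficient₄ : 0# ≈ δ * φ^[ 5 ] (β * c) + φ^[ 8 ] 0#
    coefficient₄ = coefficient (# 4)
    coefficient₃ : d * b ≈ δ * φ^[ 5 ] 0# + φ^[ 8 ] β
    coefficient₃ = coefficient (# 3)
    β≈0 : β ≈ 0#
    β≈0 = y≉0∧x*y≈0⇒x≈0 inverse c≉0 (0≈δφˢx+φᵗ0⇒x≈0 5 8 δ≉0 coefficient₄)
    d≈0 : d ≈ 0#
    d≈0 = y≉0∧x*y≈0⇒x≈0 inverse b≉0 (trans coefficient₃ (δφˢx+φᵗy≈0 δ 5 8 refl β≈0))

  ¬GLEquivalence[δx^q+x^q⁵] : ∀ {δ} → ¬ GLEquivalence (λ x → δ * fr 1 x + fr 5 x)
  ¬GLEquivalence[δx^q+x^q⁵] {δ} E = c≉b^[1+q²] (*-cancelˡ inverse β≉0 (begin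
    β * c                          ≈⟨ untwist coefficient₄ ⟩
    φ δ * φ^[ 2 ] (β * b)          ≈⟨ *-congˡ (φ^[]-* 2 β b) ⟩
    φ δ * (φ^[ 2 ] β * φ^[ 2 ] b)  ≈⟨ sym (*-assoc _ _ _) ⟩
    (φ δ * φ^[ 2 ] β) * φ^[ 2 ] b  ≈⟨ *-congʳ (sym (untwist coefficient₂)) ⟩
    (β * b) * φ^[ 2 ] b            ≈⟨ *-assoc β b _ ⟩
    β * (b * φ^[ 2 ] b)            ≈⟨ *-congˡ (*-congˡ (sym (fr≈φ^[] 2 b))) ⟩
    β * (b * fr 2 b)               ∎))
    where
    open GLEquivalence E
    coefficient : ∀ i → combination γ d b c i ≈ binomial δ 1 5 (combination a β b c) i
    coefficient = coefficient-identity E {binomial δ 1 5} (binomial-represents δ 1 5) (binomial-cong δ 1 5)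
    coefficient₂ : 0# ≈ δ * φ^[ 1 ] β + φ^[ 5 ] (β * b)
    coefficient₂ = coefficient (# 2)
    coefficient₃ : d * b ≈ δ * φ^[ 1 ] 0# + φ^[ 5 ] 0#
    coefficient₃ = coefficient (# 3)
    coefficient₄ : 0# ≈ δ * φ^[ 1 ] (β * b) + φ^[ 5 ] (β * c)
    coefficient₄ = coefficient (# 4)
    β≉0 : β ≉ 0#
    β≉0 β≈0 = singular E β≈0 (y≉0∧x*y≈0⇒x≈0 inverse b≉0 (trans coefficient₃ (δφˢx+φᵗy≈0 δ 1 5 refl refl)))
    untwist : ∀ {x y} → 0# ≈ δ * φ x + φ^[ 5 ] y → y ≈ φ δ * φ^[ 2 ] x
    untwist {x} {y} 0≈δφx+φ⁵y = begin
      y                ≈⟨ sym (φ^[]-period y) ⟩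
      φ (φ^[ 5 ] y)    ≈⟨ fr-cong 1 (sym (0≈x+y⇒x≈y 0≈δφx+φ⁵y)) ⟩
      φ (δ * φ x)      ≈⟨ fr-* 1 δ (φ x) ⟩
      φ δ * φ^[ 2 ] x  ∎

  ¬GLEquivalence[δx^q⁵+x^q] : ∀ {δ} → δ ≉ 0# → ¬ GLEquivalence (λ x → δ * fr 5 x + fr 1 x)
  ¬GLEquivalence[δx^q⁵+x^q] {δ} δ≉0 E = c≉b^[1+q²] (*-cancelˡ inverse β≉0 (*-cancelˡ inverse φδ≉0 (begin
    φ δ * (β * c)                  ≈⟨ sym (untwist coefficient₄) ⟩
    φ^[ 2 ] (β * b)                ≈⟨ φ^[]-* 2 β b ⟩
    φ^[ 2 ] β * φ^[ 2 ] b          ≈⟨ *-congʳ (untwist coefficient₂) ⟩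
    (φ δ * (β * b)) * φ^[ 2 ] b    ≈⟨ solve 4 (λ φδ β b φ²b → (φδ :* (β :* b)) :* φ²b := φδ :* (β :* (b :* φ²b)))
                                        refl (φ δ) β b _ ⟩
    φ δ * (β * (b * φ^[ 2 ] b))    ≈⟨ *-congˡ (*-congˡ (*-congˡ (sym (fr≈φ^[] 2 b)))) ⟩
    φ δ * (β * (b * fr 2 b))       ∎)))
    where
    open GLEquivalence E
    coefficient : ∀ i → combination γ d b c i ≈ binomial δ 5 1 (combination a β b c) i
    coefficient = coefficient-identity E {binomial δ 5 1} (binomial-represents δ 5 1) (binomial-cong δ 5 1)
    coefficient₂ : 0# ≈ δ * φ^[ 5 ] (β * b) + φ^[ 1 ] β
    coefficient₂ = coefficient (# 2)
    coefficient₃ : d * b ≈ δ * φ^[ 5 ] 0# + φ^[ 1 ] 0#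
    coefficient₃ = coefficient (# 3)
    coefficient₄ : 0# ≈ δ * φ^[ 5 ] (β * c) + φ^[ 1 ] (β * b)
    coefficient₄ = coefficient (# 4)
    β≉0 : β ≉ 0#
    β≉0 β≈0 = singular E β≈0 (y≉0∧x*y≈0⇒x≈0 inverse b≉0 (trans coefficient₃ (δφˢx+φᵗy≈0 δ 5 1 refl refl)))
    φδ≉0 : φ δ ≉ 0#
    φδ≉0 φδ≈0 = δ≉0 (fr≈0⇒≈0 1 φδ≈0)
    untwist : ∀ {x y} → 0# ≈ δ * φ^[ 5 ] y + φ x → φ^[ 2 ] x ≈ φ δ * y
    untwist {x} {y} 0≈δφ⁵y+φx = begin
      φ (φ x)              ≈⟨ fr-cong 1 (sym (0≈x+y⇒x≈y 0≈δφ⁵y+φx)) ⟩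
      φ (δ * φ^[ 5 ] y)    ≈⟨ fr-* 1 δ _ ⟩
      φ δ * φ^[ 6 ] y      ≈⟨ *-congˡ (φ^[]-period y) ⟩
      φ δ * y              ∎

open import Data.Nat using (ℕ; _^_; _≤_; _+_)
open import Data.Nat.GCD using (gcd)
open import Data.Product using (_×_)
open import Data.Sum using (_⊎_; inj₁; inj₂)

lemma2p1 : (h : ℕ) → 1 ≤ h →
    (R : CommutativeRing 0ℓ 0ℓ) → IsFiniteFieldOfOrder R ((2 ^ h) ^ 6) →
    let open FieldDefs R (2 ^ h)
        q = 2 ^ h
    in (b c : Carrier) → ¬ (b ≈ 0#) → ¬ (c ≈ 0#) →
       ¬ (c ≈ pow b (q ^ 2 + 1)) →
       ((s : ℕ) → (s ≡ 1 ⊎ s ≡ 5) → ¬ ΓLEquiv (U-bc b c) (U1 s)) ×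
       ((s : ℕ) → (δ : Carrier) → (s ≡ 1 ⊎ s ≡ 5) →
          ¬ (N6/1 δ ≈ 0#) → ¬ (N6/1 δ ≈ 1#) →
          ¬ ΓLEquiv (U-bc b c) (U2 s δ)) ×
       ((s : ℕ) → (δ : Carrier) → 1 ≤ s → s ≤ 5 → gcd s 3 ≡ 1 →
          ¬ (N6/3 δ ≈ 0#) → ¬ (N6/3 δ ≈ 1#) →
          MaximumScattered (U3 s δ) →
          ¬ ΓLEquiv (U-bc b c) (U3 s δ))
lemma2p1 h 1≤h R F b c b≉0 c≉0 c≉b^[q²+1] =
  (λ { 1 (inj₁ ≡.refl) → ¬GLEquivalence[x^q] ∘ reduce (fr-cong 1)
     ; 5 (inj₂ ≡.refl) → ¬GLEquivalence[x^q⁵] ∘ reduce (fr-cong 5) }) ,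
  (λ { 1 δ (inj₁ ≡.refl) _ _ → ¬GLEquivalence[δx^q+x^q⁵] ∘ reduce (binomial-cong δ 1 5)
     ; 5 δ (inj₂ ≡.refl) N≉0 _ → ¬GLEquivalence[δx^q⁵+x^q] (N6/1≉0⇒≉0 N≉0) ∘ reduce (binomial-cong δ 5 1) }) ,
  (λ { 1 δ _ _ _ N≉0 _ _ → ¬GLEquivalence[δx^q+x^q⁴] (N6/3≉0⇒≉0 N≉0) ∘ reduce (binomial-cong δ 1 4)
     ; 2 δ _ _ _ _   _ _ → ¬GLEquivalence[δx^q²+x^q⁵] ∘ reduce (binomial-cong δ 2 5)
     ; 4 δ _ _ _ _   _ _ → ¬GLEquivalence[δx^q⁴+x^q⁷] ∘ reduce (binomial-cong δ 4 7)
     ; 5 δ _ _ _ N≉0 _ _ → ¬GLEquivalence[δx^q⁵+x^q⁸] (N6/3≉0⇒≉0 N≉0) ∘ reduce (binomial-cong δ 5 8)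
     ; 3 δ _ _ () _ _ _
     ; (suc (suc (suc (suc (suc (suc _)))))) δ _ (s≤s (s≤s (s≤s (s≤s (s≤s ()))))) _ _ _ _ })
  where
  open FieldDefs R (2 ^ h)
  open Frobenius R {h} {5} 1≤h F using (fr-cong)
  open GraphEquivalence R 1≤h F
  reduce : ∀ {g} → (∀ {x y} → x ≈ y → g x ≈ g y) → ΓLEquiv (U-bc b c) (Graph g) → GLEquivalence g
  reduce = ΓLEquiv⇒GLEquivalence b≉0 c≉0 c≉b^[q²+1]
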